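{- For any integers $m\ge 4$ and $0\le t\le m-1$, \[ r\bigl(C_4,B_{(m-1)^2+(t-2)}\bigr)\le m^2+t. \]
   Context: For graphs $H_1,H_2$, the Ramsey number $r(H_1,H_2)$ is the smallest integer $N$ such that for every graph $G$ on $N$ vertices, either $G$ contains $H_1$ as a subgraph or the complement $\overline{G}$ contains $H_2$ as a subgraph. $C_4$ denotes the cycle of length 4. For $n\ge 1$, the book $B_n$ is the graph consisting of $n$ triangles sharing a common edge (i.e. $K_2$ joined to an independent set of $n$ vertices). -}

module Defs where

open import Data.Nat using (ℕ; zero; suc; _+_; _∸_; _^_; _≤_)
open import Data.Fin using (Fin; zero; suc)
open import Data.Fin.Properties using (_≟_)
open import Data.Bool using (Bool; true; false; not; _∧_; _∨_)
open import Data.Product using (Σ; _×_; ∃-syntax)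
open import Relation.Nullary.Decidable using (⌊_⌋)
open import Relation.Binary.PropositionalEquality using (_≡_; refl)
open import Function.Definitions using (Injective)
open import Relation.Nullary using (yes; no)
open import Data.Empty using (⊥-elim)
open import Data.Sum using (_⊎_)

record Graph (n : ℕ) : Set where
  field
    adj      : Fin n → Fin n → Bool
    sym      : ∀ i j → adj i j ≡ adj j i
    loopless : ∀ i → adj i i ≡ false
open Graph public

complement : ∀ {n} → Graph n → Graph n
complement {n} G = record { adj = a ; sym = s ; loopless = l }
  where
  a : Fin n → Fin n → Bool
  a i j = not (adj G i j) ∧ not ⌊ i ≟ j ⌋
  s : ∀ i j → a i j ≡ a j i
  s i j rewrite Graph.sym G i j with i ≟ j | j ≟ i
  ... | yes _ | yes _ = refl
  ... | no _  | no _  = refl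
  ... | yes refl | no q = ⊥-elim (q refl)
  ... | no q | yes refl = ⊥-elim (q refl)
  l : ∀ i → a i i ≡ false
  l i rewrite loopless G i with i ≟ i
  ... | yes _ = refl
  ... | no q = ⊥-elim (q refl)

_⊆G_ : ∀ {k n} → Graph k → Graph n → Set
_⊆G_ {k} {n} H G =
  Σ (Fin k → Fin n) λ f →
    Injective _≡_ _≡_ f × (∀ i j → adj H i j ≡ true → adj G (f i) (f j) ≡ true)

c4adj : Fin 4 → Fin 4 → Bool
c4adj zero (suc zero) = true
c4adj zero (suc (suc (suc zero))) = true
c4adj (suc zero) zero = true
c4adj (suc zero) (suc (suc zero)) = true
c4adj (suc (suc zero)) (suc zero) = true
c4adj (suc (suc zero)) (suc (suc (suc zero))) = true
c4adj (suc (suc (suc zero))) (suc (suc zero)) = true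
c4adj (suc (suc (suc zero))) zero = true
c4adj _ _ = false

C4 : Graph 4
C4 = record { adj = c4adj ; sym = s ; loopless = l }
  where
  s : ∀ i j → c4adj i j ≡ c4adj j i
  s zero zero = refl
  s zero (suc zero) = refl
  s zero (suc (suc zero)) = refl
  s zero (suc (suc (suc zero))) = refl
  s (suc zero) zero = refl
  s (suc zero) (suc zero) = refl
  s (suc zero) (suc (suc zero)) = refl
  s (suc zero) (suc (suc (suc zero))) = refl
  s (suc (suc zero)) zero = refl
  s (suc (suc zero)) (suc zero) = refl
  s (suc (suc zero)) (suc (suc zero)) = refl
  s (suc (suc zero)) (suc (suc (suc zero))) = refl
  s (suc (suc (suc zero))) zero = refl
  s (suc (suc (suc zero))) (suc zero) = refl
  s (suc (suc (suc zero))) (suc (suc zero)) = refl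
  s (suc (suc (suc zero))) (suc (suc (suc zero))) = refl
  l : ∀ i → c4adj i i ≡ false
  l zero = refl
  l (suc zero) = refl
  l (suc (suc zero)) = refl
  l (suc (suc (suc zero))) = refl

-- The book B_n on vertex set Fin (2 + n): vertices 0 and 1 form the spine
-- (adjacent to each other and to every other vertex); the remaining n
-- vertices (the pages) form an independent set.
badj : ∀ {n} → Fin (2 + n) → Fin (2 + n) → Bool
badj zero zero = false
badj zero (suc _) = true
badj (suc zero) zero = true
badj (suc zero) (suc zero) = false
badj (suc zero) (suc (suc _)) = true
badj (suc (suc _)) zero = true
badj (suc (suc _)) (suc zero) = true
badj (suc (suc _)) (suc (suc _)) = false

Book : (n : ℕ) → Graph (2 + n)
Book n = record { adj = badj ; sym = s ; loopless = l }
  where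
  s : ∀ i j → badj {n} i j ≡ badj j i
  s zero zero = refl
  s zero (suc zero) = refl
  s zero (suc (suc _)) = refl
  s (suc zero) zero = refl
  s (suc zero) (suc zero) = refl
  s (suc zero) (suc (suc _)) = refl
  s (suc (suc _)) zero = refl
  s (suc (suc _)) (suc zero) = refl
  s (suc (suc _)) (suc (suc _)) = refl
  l : ∀ i → badj {n} i i ≡ false
  l zero = refl
  l (suc zero) = refl
  l (suc (suc _)) = refl

Arrows : ∀ {k l} → ℕ → Graph k → Graph l → Set
Arrows N H1 H2 = (G : Graph N) → (H1 ⊆G G) ⊎ (H2 ⊆G complement G)

-- r(H1,H2) ≤ M : the least N with the arrow property is at most M,
-- i.e. some N ≤ M has the arrow property.
RamseyLE : ∀ {k l} → Graph k → Graph l → ℕ → Set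
RamseyLE H1 H2 M = ∃[ N ] (N ≤ M × Arrows N H1 H2)

-- Let G on N = m² + t vertices contain no C₄ while its complement contains no
-- B_n, n = (m − 1)² + t − 2. The second condition says that distinct non-adjacent
-- vertices u, v have |N(u) ∪ N(v)| ≥ 2m, for otherwise at least N − (2m − 1) − 2 = n
-- vertices are adjacent to neither. As G has no C₄, distinct paths y – x – z with
-- z ≠ y have distinct ends z, so Σ_{x ~ y} (deg x − 1) < N < m(m + 1) for every y.
-- Call x low if deg x ≤ m and high otherwise. Then every vertex has at most m high
-- neighbours, which forces every degree to be at least m and every high vertex to
-- have two low neighbours; and two low vertices u, w with a common neighbour are
-- adjacent, since otherwise |N(u) ∪ N(w)| < deg u + deg w ≤ 2m. Now take a low
-- vertex u, a low neighbour k of u, and a neighbour z of u not adjacent to k (u and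
-- k have at most one common neighbour, and deg u ≥ 3). The vertex z cannot be low,
-- and if it is high, a low neighbour k' ≠ u of z is adjacent to both u and k,
-- closing the four-cycle u k k' z.

module Submission where

open import Defs hiding (sym)
open import Data.Nat using (ℕ; zero; suc; _+_; _*_; _∸_; _^_; _≤_; _<_; z≤n; s≤s; s≤s⁻¹)
open import Data.Nat.Properties hiding (_≟_; suc-injective; 0≢1+n)
open import Data.Nat.Tactic.RingSolver using (solve-∀)
open import Algebra.Properties.Semiring.Sum +-*-semiring
  using (sum; sum-syntax; sum-cong-≗; ∑-distrib-+; ∑-comm; *-distribˡ-sum)
open import Data.Bool using (T; true; false; if_then_else_)
open import Data.Bool.Properties using (T-≡)
open import Data.Fin using (Fin; zero; suc; fromℕ<)
open import Data.Fin.Properties using (_≟_; any?; suc-injective; 0≢1+n)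
open import Data.Product using (Σ-syntax; ∃; _×_; _,_; proj₁; proj₂)
open import Data.Sum using (_⊎_; inj₁; inj₂)
open import Data.Empty using (⊥; ⊥-elim)
open import Data.Vec.Functional using (_∷_; [])
open import Function using (_∘_; case_of_)
open import Function.Bundles using (Equivalence)
open import Function.Definitions using (Injective)
open import Level using (0ℓ)
open import Relation.Nullary using (Dec; does; yes; no; ¬_; ¬?; _×-dec_; T?)
open import Relation.Unary using (Pred; Decidable; ∁; _⊆_)
open import Relation.Unary.Properties using (∁?; _∪?_; _∩?_)
open import Relation.Binary.PropositionalEquality
  using (_≡_; _≢_; refl; cong; sym; trans; subst; module ≡-Reasoning)

𝟙 : ∀ {A : Set} → Dec A → ℕ
𝟙 a? = if does a? then 1 else 0

count : ∀ {n} {P : Pred (Fin n) 0ℓ} → Decidable P → ℕ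
count {n} P? = ∑[ i < n ] 𝟙 (P? i)

∑-mono-≤ : ∀ {n} {f g : Fin n → ℕ} → (∀ i → f i ≤ g i) → sum f ≤ sum g
∑-mono-≤ {zero}  f≤g = z≤n
∑-mono-≤ {suc n} f≤g = +-mono-≤ (f≤g zero) (∑-mono-≤ (f≤g ∘ suc))

module _ {n} {P Q : Pred (Fin n) 0ℓ} (P? : Decidable P) (Q? : Decidable Q) where

  count-mono : P ⊆ Q → count P? ≤ count Q?
  count-mono P⊆Q = ∑-mono-≤ 𝟙-mono
    where
    𝟙-mono : ∀ i → 𝟙 (P? i) ≤ 𝟙 (Q? i)
    𝟙-mono i with P? i | Q? i
    ... | no _  | _      = z≤n
    ... | yes _ | yes _  = ≤-refl
    ... | yes p | no ¬q  = ⊥-elim (¬q (P⊆Q p))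

  count-∪ : count {n} (P? ∪? Q?) + count {n} (P? ∩? Q?) ≡ count P? + count Q?
  count-∪ = trans (sym (∑-distrib-+ (𝟙 ∘ (P? ∪? Q?)) (𝟙 ∘ (P? ∩? Q?))))
                  (trans (sum-cong-≗ 𝟙-∪) (∑-distrib-+ (𝟙 ∘ P?) (𝟙 ∘ Q?)))
    where
    𝟙-∪ : ∀ i → 𝟙 ((P? ∪? Q?) i) + 𝟙 ((P? ∩? Q?) i) ≡ 𝟙 (P? i) + 𝟙 (Q? i)
    𝟙-∪ i with P? i | Q? i
    ... | yes _ | yes _ = refl
    ... | yes _ | no _  = refl
    ... | no _  | yes _ = refl
    ... | no _  | no _  = refl

  count-∪-≤ : count {n} (P? ∪? Q?) ≤ count P? + count Q?
  count-∪-≤ = ≤-trans (m≤m+n _ _) (≤-reflexive count-∪)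

count-∁ : ∀ {n} {P : Pred (Fin n) 0ℓ} (P? : Decidable P) → count P? + count (∁? P?) ≡ n
count-∁ {n} P? =
  trans (sym (∑-distrib-+ (𝟙 ∘ P?) (𝟙 ∘ ∁? P?))) (trans (sum-cong-≗ 𝟙-∁) (∑1≡n n))
  where
  𝟙-∁ : ∀ i → 𝟙 (P? i) + 𝟙 (∁? P? i) ≡ 1
  𝟙-∁ i with P? i
  ... | yes _ = refl
  ... | no _  = refl
  ∑1≡n : ∀ n → ∑[ i < n ] 1 ≡ n
  ∑1≡n zero    = refl
  ∑1≡n (suc n) = cong suc (∑1≡n n)

count-witness : ∀ {n} {P : Pred (Fin n) 0ℓ} (P? : Decidable P) → 0 < count P? → ∃ P
count-witness {zero} P? ()
count-witness {suc n} P? 0<c with P? zero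
... | yes p = zero , p
... | no _  = let (i , p) = count-witness (P? ∘ suc) 0<c in suc i , p

witness-count : ∀ {n} {P : Pred (Fin n) 0ℓ} (P? : Decidable P) {i} → P i → 0 < count P?
witness-count P? {zero} p with P? zero
... | yes _ = s≤s z≤n
... | no ¬p = ⊥-elim (¬p p)
witness-count P? {suc i} p = ≤-trans (witness-count (P? ∘ suc) p) (m≤n+m _ (𝟙 (P? zero)))

count≤1 : ∀ {n} {P : Pred (Fin n) 0ℓ} (P? : Decidable P) →
          (∀ {i j} → P i → P j → i ≡ j) → count P? ≤ 1
count≤1 {zero} P? unique = z≤n
count≤1 {suc n} P? unique with P? zero
... | yes p = s≤s (≮⇒≥ λ 0<c → 0≢1+n (unique p (proj₂ (count-witness (P? ∘ suc) 0<c))))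
... | no _  = count≤1 (P? ∘ suc) (λ p q → suc-injective (unique p q))

count-≡≤1 : ∀ {n} (w : Fin n) → count (_≟ w) ≤ 1
count-≡≤1 w = count≤1 (_≟ w) (λ p q → trans p (sym q))

count≤suc-count-≢ : ∀ {n} {P : Pred (Fin n) 0ℓ} (P? : Decidable P) (w : Fin n) →
                    count P? ≤ suc (count (P? ∩? ∁? (_≟ w)))
count≤suc-count-≢ {P = P} P? w = begin
  count P?                    ≤⟨ count-mono P? ((_≟ w) ∪? P?∖w) split ⟩
  count ((_≟ w) ∪? P?∖w)      ≤⟨ count-∪-≤ (_≟ w) P?∖w ⟩
  count (_≟ w) + count P?∖w   ≤⟨ +-monoˡ-≤ (count P?∖w) (count-≡≤1 w) ⟩
  suc (count P?∖w)            ∎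
  where
  open ≤-Reasoning
  P?∖w : Decidable (λ i → P i × i ≢ w)
  P?∖w = P? ∩? ∁? (_≟ w)
  split : ∀ {i} → P i → i ≡ w ⊎ (P i × i ≢ w)
  split {i} p with i ≟ w
  ... | yes i≡w = inj₁ i≡w
  ... | no i≢w  = inj₂ (p , i≢w)

count⇒injection : ∀ {n k} {P : Pred (Fin n) 0ℓ} (P? : Decidable P) → k ≤ count P? →
                  Σ[ g ∈ (Fin k → Fin n) ] Injective _≡_ _≡_ g × (∀ i → P (g i))
count⇒injection {k = zero} P? _ = (λ ()) , (λ { {()} }) , (λ ())
count⇒injection {zero} {suc k} P? ()
count⇒injection {suc n} {suc k} P? k≤c with P? zero
... | yes p = let (g , g-inj , Pg) = count⇒injection (P? ∘ suc) (s≤s⁻¹ k≤c) in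
              (zero ∷ suc ∘ g) , ∷-injective g-inj , λ { zero → p ; (suc i) → Pg i }
  where
  ∷-injective : ∀ {g : Fin k → Fin n} →
                Injective _≡_ _≡_ g → Injective _≡_ _≡_ (zero ∷ suc ∘ g)
  ∷-injective g-inj {zero}  {zero}  _ = refl
  ∷-injective g-inj {suc i} {suc j} e = cong suc (g-inj (suc-injective e))
... | no _  = let (g , g-inj , Pg) = count⇒injection (P? ∘ suc) k≤c in
              suc ∘ g , g-inj ∘ suc-injective , Pg

count≤𝟙 : ∀ {n} {P : Pred (Fin n) 0ℓ} {Q : Set} (P? : Decidable P) (Q? : Dec Q) →
          (∀ {i} → P i → Q) → (∀ {i j} → P i → P j → i ≡ j) → count P? ≤ 𝟙 Q?
count≤𝟙 P? (yes _) _   unique = count≤1 P? unique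
count≤𝟙 P? (no ¬q) P⇒Q _      = ≮⇒≥ λ 0<c → ¬q (P⇒Q (proj₂ (count-witness P? 0<c)))

*-distribˡ-count : ∀ {n} {P : Pred (Fin n) 0ℓ} (m : ℕ) (P? : Decidable P) →
                   m * count P? ≡ ∑[ i < n ] (m * 𝟙 (P? i))
*-distribˡ-count m P? = *-distribˡ-sum m (𝟙 ∘ P?)

count<n⇒∃∁ : ∀ {n} {P : Pred (Fin n) 0ℓ} (P? : Decidable P) → count P? < n → ∃ (∁ P)
count<n⇒∃∁ {n} P? c<n = count-witness (∁? P?) (+-cancelˡ-< (count P?) 0 (count (∁? P?)) c+0<c+c')
  where
  open ≤-Reasoning
  c+0<c+c' : count P? + 0 < count P? + count (∁? P?)
  c+0<c+c' = begin-strict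
    count P? + 0               ≡⟨ +-identityʳ (count P?) ⟩
    count P?                   <⟨ c<n ⟩
    n                          ≡⟨ count-∁ P? ⟨
    count P? + count (∁? P?)   ∎

module Neighbourhoods {n} (G : Graph n) where

  infix 4 _~_ _~?_

  _~_ : Fin n → Fin n → Set
  u ~ v = T (adj G u v)

  _~?_ : ∀ u v → Dec (u ~ v)
  u ~? v = T? (adj G u v)

  ~-sym : ∀ {u v} → u ~ v → v ~ u
  ~-sym {u} {v} = subst T (Graph.sym G u v)

  ~-irrefl : ∀ {u v} → u ~ v → u ≢ v
  ~-irrefl {u} u~u refl = subst T (loopless G u) u~u

  ~⇒adj : ∀ {u v} → u ~ v → adj G u v ≡ true
  ~⇒adj = Equivalence.to T-≡

  ≁⇒adjᶜ : ∀ {u v} → u ≢ v → ¬ u ~ v → adj (complement G) u v ≡ true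
  ≁⇒adjᶜ {u} {v} u≢v u≁v with adj G u v | u ≟ v
  ... | false | no _    = refl
  ... | true  | _       = ⊥-elim (u≁v _)
  ... | false | yes u≡v = ⊥-elim (u≢v u≡v)

  deg : Fin n → ℕ
  deg u = count (u ~?_)

  deg∪ : Fin n → Fin n → ℕ
  deg∪ u v = count ((u ~?_) ∪? (v ~?_))

  codeg : Fin n → Fin n → ℕ
  codeg u v = count ((u ~?_) ∩? (v ~?_))

  LargeUnions : ℕ → Set
  LargeUnions k = ∀ {u v} → u ≢ v → ¬ u ~ v → k ≤ deg∪ u v

  FourCycle : Fin n → Fin n → Fin n → Fin n → Set
  FourCycle a b c d = (a ~ b × b ~ c × c ~ d × d ~ a) × a ≢ c × b ≢ d

  FourCycleFree : Set
  FourCycleFree = ∀ {a b c d} → ¬ FourCycle a b c d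

  fourCycle? : Dec (∃ λ a → ∃ λ b → ∃ λ c → ∃ λ d → FourCycle a b c d)
  fourCycle? = any? λ a → any? λ b → any? λ c → any? λ d →
    (a ~? b ×-dec b ~? c ×-dec c ~? d ×-dec d ~? a) ×-dec ¬? (a ≟ c) ×-dec ¬? (b ≟ d)

  fourCycle⇒C4⊆G : ∀ {a b c d} → FourCycle a b c d → C4 ⊆G G
  fourCycle⇒C4⊆G {a} {b} {c} {d} ((ab , bc , cd , da) , a≢c , b≢d) = f , f-injective , f-edges
    where
    f : Fin 4 → Fin n
    f = a ∷ b ∷ c ∷ d ∷ []
    f-injective : Injective _≡_ _≡_ f
    f-injective {zero}                {zero}                _ = refl
    f-injective {zero}                {suc zero}            e = ⊥-elim (~-irrefl ab e)
    f-injective {zero}                {suc (suc zero)}      e = ⊥-elim (a≢c e)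
    f-injective {zero}                {suc (suc (suc zero))} e = ⊥-elim (~-irrefl da (sym e))
    f-injective {suc zero}            {zero}                e = ⊥-elim (~-irrefl ab (sym e))
    f-injective {suc zero}            {suc zero}            _ = refl
    f-injective {suc zero}            {suc (suc zero)}      e = ⊥-elim (~-irrefl bc e)
    f-injective {suc zero}            {suc (suc (suc zero))} e = ⊥-elim (b≢d e)
    f-injective {suc (suc zero)}      {zero}                e = ⊥-elim (a≢c (sym e))
    f-injective {suc (suc zero)}      {suc zero}            e = ⊥-elim (~-irrefl bc (sym e))
    f-injective {suc (suc zero)}      {suc (suc zero)}      _ = refl
    f-injective {suc (suc zero)}      {suc (suc (suc zero))} e = ⊥-elim (~-irrefl cd e)
    f-injective {suc (suc (suc zero))} {zero}                e = ⊥-elim (~-irrefl da e)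
    f-injective {suc (suc (suc zero))} {suc zero}            e = ⊥-elim (b≢d (sym e))
    f-injective {suc (suc (suc zero))} {suc (suc zero)}      e = ⊥-elim (~-irrefl cd (sym e))
    f-injective {suc (suc (suc zero))} {suc (suc (suc zero))} _ = refl
    f-edges : ∀ i j → adj C4 i j ≡ true → adj G (f i) (f j) ≡ true
    f-edges zero                   (suc zero)             _ = ~⇒adj ab
    f-edges (suc zero)             (suc (suc zero))       _ = ~⇒adj bc
    f-edges (suc (suc zero))       (suc (suc (suc zero))) _ = ~⇒adj cd
    f-edges (suc (suc (suc zero))) zero                   _ = ~⇒adj da
    f-edges (suc zero)             zero                   _ = ~⇒adj (~-sym ab)
    f-edges (suc (suc zero))       (suc zero)             _ = ~⇒adj (~-sym bc)
    f-edges (suc (suc (suc zero))) (suc (suc zero))       _ = ~⇒adj (~-sym cd)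
    f-edges zero                   (suc (suc (suc zero))) _ = ~⇒adj (~-sym da)
    f-edges zero                   zero                   ()
    f-edges zero                   (suc (suc zero))       ()
    f-edges (suc zero)             (suc zero)             ()
    f-edges (suc zero)             (suc (suc (suc zero))) ()
    f-edges (suc (suc zero))       zero                   ()
    f-edges (suc (suc zero))       (suc (suc zero))       ()
    f-edges (suc (suc (suc zero))) (suc zero)             ()
    f-edges (suc (suc (suc zero))) (suc (suc (suc zero))) ()

  CommonNonNeighbour : Fin n → Fin n → Fin n → Set
  CommonNonNeighbour u v w = ¬ u ~ w × ¬ v ~ w × w ≢ u × w ≢ v

  commonNonNeighbour? : ∀ u v → Decidable (CommonNonNeighbour u v)
  commonNonNeighbour? u v w = ¬? (u ~? w) ×-dec ¬? (v ~? w) ×-dec ¬? (w ≟ u) ×-dec ¬? (w ≟ v)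

  n≤commonNonNeighbours+deg∪+2 : ∀ u v → n ≤ count (commonNonNeighbour? u v) + (deg∪ u v + 2)
  n≤commonNonNeighbours+deg∪+2 u v = begin
    n                          ≡⟨ count-∁ C? ⟨
    count C? + count (∁? C?)   ≤⟨ +-monoʳ-≤ (count C?) outside≤ ⟩
    count C? + (deg∪ u v + 2)  ∎
    where
    open ≤-Reasoning
    C? : Decidable (CommonNonNeighbour u v)
    C? = commonNonNeighbour? u v
    N∪N? : Decidable (λ w → u ~ w ⊎ v ~ w)
    N∪N? = (u ~?_) ∪? (v ~?_)
    ≡u∪v? : Decidable (λ w → w ≡ u ⊎ w ≡ v)
    ≡u∪v? = (_≟ u) ∪? (_≟ v)
    outside : ∀ {w} → ¬ CommonNonNeighbour u v w → (u ~ w ⊎ v ~ w) ⊎ w ≡ u ⊎ w ≡ v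
    outside {w} ¬C with u ~? w | v ~? w | w ≟ u | w ≟ v
    ... | yes u~w | _       | _       | _       = inj₁ (inj₁ u~w)
    ... | no _    | yes v~w | _       | _       = inj₁ (inj₂ v~w)
    ... | no _    | no _    | yes w≡u | _       = inj₂ (inj₁ w≡u)
    ... | no _    | no _    | no _    | yes w≡v = inj₂ (inj₂ w≡v)
    ... | no u≁w  | no v≁w  | no w≢u  | no w≢v  = ⊥-elim (¬C (u≁w , v≁w , w≢u , w≢v))
    outside≤ : count (∁? C?) ≤ deg∪ u v + 2
    outside≤ = begin
      count (∁? C?)                              ≤⟨ count-mono (∁? C?) (N∪N? ∪? ≡u∪v?) outside ⟩
      count (N∪N? ∪? ≡u∪v?)                      ≤⟨ count-∪-≤ N∪N? ≡u∪v? ⟩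
      deg∪ u v + count ≡u∪v?                     ≤⟨ +-monoʳ-≤ (deg∪ u v) (count-∪-≤ (_≟ u) (_≟ v)) ⟩
      deg∪ u v + (count (_≟ u) + count (_≟ v))   ≤⟨ +-monoʳ-≤ (deg∪ u v) (+-mono-≤ (count-≡≤1 u) (count-≡≤1 v)) ⟩
      deg∪ u v + 2                               ∎

  book⊆complement : ∀ {u v k} (g : Fin k → Fin n) → u ≢ v → ¬ u ~ v → Injective _≡_ _≡_ g →
                    (∀ i → CommonNonNeighbour u v (g i)) → Book k ⊆G complement G
  book⊆complement {u} {v} {k} g u≢v u≁v g-injective gC = f , f-injective , f-edges
    where
    u≁g : ∀ i → ¬ u ~ g i
    u≁g i = proj₁ (gC i)
    v≁g : ∀ i → ¬ v ~ g i
    v≁g i = proj₁ (proj₂ (gC i))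
    g≢u : ∀ i → g i ≢ u
    g≢u i = proj₁ (proj₂ (proj₂ (gC i)))
    g≢v : ∀ i → g i ≢ v
    g≢v i = proj₂ (proj₂ (proj₂ (gC i)))
    f : Fin (2 + k) → Fin n
    f = u ∷ v ∷ g
    f-injective : Injective _≡_ _≡_ f
    f-injective {zero}        {zero}        _ = refl
    f-injective {zero}        {suc zero}    e = ⊥-elim (u≢v e)
    f-injective {zero}        {suc (suc j)} e = ⊥-elim (g≢u j (sym e))
    f-injective {suc zero}    {zero}        e = ⊥-elim (u≢v (sym e))
    f-injective {suc zero}    {suc zero}    _ = refl
    f-injective {suc zero}    {suc (suc j)} e = ⊥-elim (g≢v j (sym e))
    f-injective {suc (suc i)} {zero}        e = ⊥-elim (g≢u i e)
    f-injective {suc (suc i)} {suc zero}    e = ⊥-elim (g≢v i e)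
    f-injective {suc (suc i)} {suc (suc j)} e = cong (λ i → suc (suc i)) (g-injective e)
    f-edges : ∀ i j → adj (Book k) i j ≡ true → adj (complement G) (f i) (f j) ≡ true
    f-edges zero          (suc zero)    _ = ≁⇒adjᶜ u≢v u≁v
    f-edges (suc zero)    zero          _ = ≁⇒adjᶜ (u≢v ∘ sym) (u≁v ∘ ~-sym)
    f-edges zero          (suc (suc j)) _ = ≁⇒adjᶜ (g≢u j ∘ sym) (u≁g j)
    f-edges (suc zero)    (suc (suc j)) _ = ≁⇒adjᶜ (g≢v j ∘ sym) (v≁g j)
    f-edges (suc (suc i)) zero          _ = ≁⇒adjᶜ (g≢u i) (u≁g i ∘ ~-sym)
    f-edges (suc (suc i)) (suc zero)    _ = ≁⇒adjᶜ (g≢v i) (v≁g i ∘ ~-sym)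
    f-edges zero          zero          ()
    f-edges (suc zero)    (suc zero)    ()
    f-edges (suc (suc i)) (suc (suc j)) ()

  module _ (cf : FourCycleFree) where

    commonNeighbour-unique : ∀ {u v x x'} → u ≢ v → u ~ x × v ~ x → u ~ x' × v ~ x' → x ≡ x'
    commonNeighbour-unique {x = x} {x'} u≢v (u~x , v~x) (u~x' , v~x') with x ≟ x'
    ... | yes x≡x' = x≡x'
    ... | no x≢x'  = ⊥-elim (cf ((u~x , ~-sym v~x , v~x' , ~-sym u~x') , u≢v , x≢x'))

    codeg≤1 : ∀ {u v} → u ≢ v → codeg u v ≤ 1
    codeg≤1 {u} {v} u≢v = count≤1 ((u ~?_) ∩? (v ~?_)) (commonNeighbour-unique u≢v)

    paths : Fin n → Fin n → ℕ
    paths y x = count (λ z → (y ~? x ×-dec x ~? z) ×-dec ¬? (z ≟ y))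

    ∑paths<n : ∀ y → ∑[ x < n ] paths y x < n
    ∑paths<n y = begin-strict
      ∑[ x < n ] paths y x                ≡⟨ ∑-comm (λ x z → 𝟙 (path? x z)) ⟩
      ∑[ z < n ] count (λ x → path? x z)  ≤⟨ ∑-mono-≤ atMostOneMiddle ⟩
      count (∁? (_≟ y))                   <⟨ m<n+m _ (witness-count (_≟ y) refl) ⟩
      count (_≟ y) + count (∁? (_≟ y))    ≡⟨ count-∁ (_≟ y) ⟩
      n                                   ∎
      where
      open ≤-Reasoning
      path? : ∀ x z → Dec ((y ~ x × x ~ z) × z ≢ y)
      path? x z = (y ~? x ×-dec x ~? z) ×-dec ¬? (z ≟ y)
      atMostOneMiddle : ∀ z → count (λ x → path? x z) ≤ 𝟙 (¬? (z ≟ y))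
      atMostOneMiddle z = count≤𝟙 (λ x → path? x z) (¬? (z ≟ y)) proj₂
        λ ((y~x , x~z) , z≢y) ((y~x' , x'~z) , _) →
          commonNeighbour-unique (z≢y ∘ sym) (y~x , ~-sym x~z) (y~x' , ~-sym x'~z)

    deg≤suc-paths : ∀ {y x} → y ~ x → deg x ≤ suc (paths y x)
    deg≤suc-paths {y} {x} y~x = ≤-trans (count≤suc-count-≢ (x ~?_) y)
      (s≤s (count-mono ((x ~?_) ∩? ∁? (_≟ y)) (λ z → (y ~? x ×-dec x ~? z) ×-dec ¬? (z ≟ y))
                       (λ (x~z , z≢y) → (y~x , x~z) , z≢y)))

    nonAdjacentNeighbour : ∀ {u k} → 3 ≤ deg u → u ~ k → ∃ λ z → u ~ z × z ≢ k × ¬ k ~ z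
    nonAdjacentNeighbour {u} {k} 3≤deg u~k =
      let (z , (u~z , z≢k) , k≁z) = count-witness Z? (s≤s⁻¹ (s≤s⁻¹ (≤-trans 3≤deg deg≤2+Z))) in
      z , u~z , z≢k , k≁z
      where
      open ≤-Reasoning
      Z? : ∀ z → Dec ((u ~ z × z ≢ k) × ¬ k ~ z)
      Z? z = (u ~? z ×-dec ¬? (z ≟ k)) ×-dec ¬? (k ~? z)
      split : ∀ {z} → u ~ z × z ≢ k → (u ~ z × k ~ z) ⊎ ((u ~ z × z ≢ k) × ¬ k ~ z)
      split {z} (u~z , z≢k) with k ~? z
      ... | yes k~z = inj₁ (u~z , k~z)
      ... | no k≁z  = inj₂ ((u~z , z≢k) , k≁z)
      N∖k? : Decidable (λ z → u ~ z × z ≢ k)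
      N∖k? = (u ~?_) ∩? ∁? (_≟ k)
      common? : Decidable (λ z → u ~ z × k ~ z)
      common? = (u ~?_) ∩? (k ~?_)
      deg≤2+Z : deg u ≤ 2 + count Z?
      deg≤2+Z = begin
        deg u                          ≤⟨ count≤suc-count-≢ (u ~?_) k ⟩
        suc (count N∖k?)               ≤⟨ s≤s (count-mono N∖k? (common? ∪? Z?) split) ⟩
        suc (count (common? ∪? Z?))    ≤⟨ s≤s (count-∪-≤ common? Z?) ⟩
        suc (codeg u k + count Z?)     ≤⟨ s≤s (+-monoˡ-≤ (count Z?) (codeg≤1 (~-irrefl u~k))) ⟩
        2 + count Z?                   ∎

module _ {n} {G : Graph n} {m : ℕ}
         (cf : Neighbourhoods.FourCycleFree G) (wide : Neighbourhoods.LargeUnions G (m + m))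
         (3≤m : 3 ≤ m) (m<n : m < n) (n<m[m+1] : n < m * suc m) where

  open Neighbourhoods G

  Low : Fin n → Set
  Low x = deg x ≤ m

  low? : Decidable Low
  low? x = deg x ≤? m

  highNeighbour? : ∀ y → Decidable (λ x → y ~ x × ¬ Low x)
  highNeighbour? y x = y ~? x ×-dec ¬? (low? x)

  lowNeighbour? : ∀ y → Decidable (λ x → y ~ x × Low x)
  lowNeighbour? y x = y ~? x ×-dec low? x

  -- The pointwise bounds below take the decisions as arguments: 'with' cannot abstract
  -- over 'y ~? x' once 𝟙 has reduced it to the underlying Boolean.

  highNeighbours≤m : ∀ y → count (highNeighbour? y) ≤ m
  highNeighbours≤m y = s≤s⁻¹ (*-cancelˡ-< m _ _ (begin-strict
    m * count (highNeighbour? y)               ≡⟨ *-distribˡ-count m (highNeighbour? y) ⟩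
    ∑[ x < n ] (m * 𝟙 (highNeighbour? y x))    ≤⟨ ∑-mono-≤ (λ x → bound (y ~? x) (low? x)) ⟩
    ∑[ x < n ] paths cf y x                    <⟨ ∑paths<n cf y ⟩
    n                                          <⟨ n<m[m+1] ⟩
    m * suc m                                  ∎))
    where
    open ≤-Reasoning
    bound : ∀ {x} (y~?x : Dec (y ~ x)) (low?x : Dec (Low x)) →
            m * 𝟙 (y~?x ×-dec ¬? low?x) ≤ paths cf y x
    bound (yes y~x) (no high) = ≤-trans (≤-reflexive (*-identityʳ m))
                                        (s≤s⁻¹ (≤-trans (≰⇒> high) (deg≤suc-paths cf y~x)))
    bound (yes _)   (yes _)   = ≤-trans (≤-reflexive (*-zeroʳ m)) z≤n
    bound (no _)    _         = ≤-trans (≤-reflexive (*-zeroʳ m)) z≤n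

  module _ {v} (deg<m : deg v < m) where

    m<remainder : ∀ {z k} → v ≢ z → ¬ v ~ z → deg∪ v z ≤ deg v + k → m < k
    m<remainder {z} {k} v≢z v≁z ∪≤ = +-cancelˡ-< m m k (begin-strict
      m + m       ≤⟨ wide v≢z v≁z ⟩
      deg∪ v z    ≤⟨ ∪≤ ⟩
      deg v + k   <⟨ +-monoˡ-< k deg<m ⟩
      m + k       ∎)
      where open ≤-Reasoning

    nonNeighbour-high : ∀ {z} → v ≢ z → ¬ v ~ z → ¬ Low z
    nonNeighbour-high {z} v≢z v≁z = <⇒≱ (m<remainder v≢z v≁z (count-∪-≤ (v ~?_) (z ~?_)))

    nonNeighbour : ∃ λ r → v ≢ r × ¬ v ~ r
    nonNeighbour =
      let (r , ¬v~r⊎r≡v) = count<n⇒∃∁ ((v ~?_) ∪? (_≟ v)) (begin-strict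
            count ((v ~?_) ∪? (_≟ v))    ≤⟨ count-∪-≤ (v ~?_) (_≟ v) ⟩
            deg v + count (_≟ v)          ≤⟨ +-monoʳ-≤ (deg v) (count-≡≤1 v) ⟩
            deg v + 1                     ≡⟨ +-comm (deg v) 1 ⟩
            suc (deg v)                   ≤⟨ deg<m ⟩
            m                             <⟨ m<n ⟩
            n                             ∎)
      in r , ¬v~r⊎r≡v ∘ inj₂ ∘ sym , ¬v~r⊎r≡v ∘ inj₁
      where open ≤-Reasoning

    m<privateNeighbours : ∀ {r} → v ≢ r → ¬ v ~ r → m < count (λ z → r ~? z ×-dec ¬? (v ~? z))
    m<privateNeighbours {r} v≢r v≁r = m<remainder v≢r v≁r (begin
      deg∪ v r                     ≤⟨ count-mono ((v ~?_) ∪? (r ~?_)) ((v ~?_) ∪? rOnly?) split ⟩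
      count ((v ~?_) ∪? rOnly?)  ≤⟨ count-∪-≤ (v ~?_) rOnly? ⟩
      deg v + count rOnly?       ∎)
      where
      open ≤-Reasoning
      rOnly? : Decidable (λ z → r ~ z × ¬ v ~ z)
      rOnly? z = r ~? z ×-dec ¬? (v ~? z)
      split : ∀ {z} → v ~ z ⊎ r ~ z → v ~ z ⊎ (r ~ z × ¬ v ~ z)
      split {z} v~z⊎r~z with v ~? z | v~z⊎r~z
      ... | yes v~z | _        = inj₁ v~z
      ... | no v≁z  | inj₁ v~z = ⊥-elim (v≁z v~z)
      ... | no v≁z  | inj₂ r~z = inj₂ (r~z , v≁z)

  -- A vertex v of degree below m has a non-neighbour r, and r has more than m
  -- neighbours outside N(v), all of them high.
  m≤deg : ∀ v → m ≤ deg v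
  m≤deg v = ≮⇒≥ λ deg<m →
    let (r , v≢r , v≁r) = nonNeighbour deg<m
        rOnly⊆high : ∀ {z} → r ~ z × ¬ v ~ z → r ~ z × ¬ Low z
        rOnly⊆high = λ (r~z , v≁z) →
          r~z , nonNeighbour-high deg<m (λ v≡z → v≁r (~-sym (subst (r ~_) (sym v≡z) r~z))) v≁z
    in <⇒≱ (m<privateNeighbours deg<m v≢r v≁r)
           (≤-trans (count-mono (λ z → r ~? z ×-dec ¬? (v ~? z)) (highNeighbour? r) rOnly⊆high)
                    (highNeighbours≤m r))

  lowNeighbours≥2 : ∀ {y} → ¬ Low y → 2 ≤ count (lowNeighbour? y)
  lowNeighbours≥2 {y} high = +-cancelˡ-≤ S 2 L (begin
    S + 2                                              ≡⟨ +-comm S 2 ⟩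
    2 + S                                              ≤⟨ s≤s (∑paths<n cf y) ⟩
    suc n                                              ≤⟨ n<m[m+1] ⟩
    m * suc m                                          ≤⟨ *-monoʳ-≤ m (≰⇒> high) ⟩
    m * deg y                                          ≡⟨ *-distribˡ-count m (y ~?_) ⟩
    ∑[ x < n ] (m * 𝟙 (y ~? x))                        ≤⟨ ∑-mono-≤ (λ x → bound (y ~? x) (low? x)) ⟩
    ∑[ x < n ] (paths cf y x + 𝟙 (lowNeighbour? y x))
                                       ≡⟨ ∑-distrib-+ (paths cf y) (𝟙 ∘ lowNeighbour? y) ⟩
    S + L                                              ∎)
    where
    open ≤-Reasoning
    S L : ℕ
    S = ∑[ x < n ] paths cf y x
    L = count (lowNeighbour? y)
    bound : ∀ {x} (y~?x : Dec (y ~ x)) (low?x : Dec (Low x)) →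
            m * 𝟙 y~?x ≤ paths cf y x + 𝟙 (y~?x ×-dec low?x)
    bound {x} (yes y~x) (yes _) = begin
      m * 1                ≡⟨ *-identityʳ m ⟩
      m                    ≤⟨ m≤deg x ⟩
      deg x                ≤⟨ deg≤suc-paths cf y~x ⟩
      suc (paths cf y x)   ≡⟨ +-comm 1 (paths cf y x) ⟩
      paths cf y x + 1     ∎
    bound {x} (yes y~x) (no high-x) = begin
      m * 1                ≡⟨ *-identityʳ m ⟩
      m                    ≤⟨ s≤s⁻¹ (≤-trans (≰⇒> high-x) (deg≤suc-paths cf y~x)) ⟩
      paths cf y x         ≡⟨ +-identityʳ (paths cf y x) ⟨
      paths cf y x + 0     ∎
    bound (no _) _ = ≤-trans (≤-reflexive (*-zeroʳ m)) z≤n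

  lowNeighbourOtherThan : ∀ {y} → ¬ Low y → ∀ w → ∃ λ w' → (y ~ w' × Low w') × w' ≢ w
  lowNeighbourOtherThan {y} high w = count-witness (lowNeighbour? y ∩? ∁? (_≟ w))
    (s≤s⁻¹ (≤-trans (lowNeighbours≥2 high) (count≤suc-count-≢ (lowNeighbour? y) w)))

  lowVertex : ∃ Low
  lowVertex = case low? v₀ of λ where
      (yes low) → v₀ , low
      (no high) → let (w , (_ , low) , _) = lowNeighbourOtherThan high v₀ in w , low
    where
    v₀ : Fin n
    v₀ = fromℕ< (≤-trans (s≤s z≤n) m<n)

  low-commonNeighbour⇒~ : ∀ {u w x} → Low u → Low w → u ≢ w → u ~ x → w ~ x → u ~ w
  low-commonNeighbour⇒~ {u} {w} {x} low-u low-w u≢w u~x w~x with u ~? w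
  ... | yes u~w = u~w
  ... | no u≁w  = ⊥-elim (n≮n (m + m) (begin-strict
    m + m                     ≤⟨ wide u≢w u≁w ⟩
    deg∪ u w                  <⟨ m<m+n (deg∪ u w) (witness-count ((u ~?_) ∩? (w ~?_)) (u~x , w~x)) ⟩
    deg∪ u w + codeg u w      ≡⟨ count-∪ (u ~?_) (w ~?_) ⟩
    deg u + deg w             ≤⟨ +-mono-≤ low-u low-w ⟩
    m + m                     ∎))
    where open ≤-Reasoning

  lowNeighbour : ∀ {u} → Low u → ∃ λ k → u ~ k × Low k
  lowNeighbour {u} low-u with count-witness (u ~?_) (≤-trans (s≤s z≤n) (≤-trans 3≤m (m≤deg u)))
  ... | x , u~x with low? x
  ...   | yes low-x = x , u~x , low-x
  ...   | no high-x = let (k , (x~k , low-k) , k≢u) = lowNeighbourOtherThan high-x u in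
                      k , low-commonNeighbour⇒~ low-u low-k (k≢u ∘ sym) u~x (~-sym x~k) , low-k

  fourCycleFree∧largeUnions⇒⊥ : ⊥
  fourCycleFree∧largeUnions⇒⊥ =
    let (u , low-u)             = lowVertex
        (k , u~k , low-k)       = lowNeighbour low-u
        (z , u~z , z≢k , k≁z)   = nonAdjacentNeighbour cf (≤-trans 3≤m (m≤deg u)) u~k
    in case low? z of λ where
      (yes low-z) → k≁z (low-commonNeighbour⇒~ low-k low-z (z≢k ∘ sym) (~-sym u~k) (~-sym u~z))
      (no high-z) →
        let (k' , (z~k' , low-k') , k'≢u) = lowNeighbourOtherThan high-z u
            u~k' = low-commonNeighbour⇒~ low-u low-k' (k'≢u ∘ sym) u~z (~-sym z~k')
            k≢k' = λ k≡k' → k≁z (~-sym (subst (z ~_) (sym k≡k') z~k'))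
            k~k' = low-commonNeighbour⇒~ low-k low-k' k≢k' (~-sym u~k) (~-sym u~k')
        in cf ((u~k , k~k' , ~-sym z~k' , ~-sym u~z) , ~-irrefl u~k' , z≢k ∘ sym)

arrows-C4-Book : ∀ {m N} k → 3 ≤ m → m < N → N < m * suc m → k + (m + m + 1) ≤ N →
                 Arrows N C4 (Book k)
arrows-C4-Book {m} {N} k 3≤m m<N N<m[m+1] k+2m+1≤N G = C4-or-book fourCycle? narrowPair?
  where
  open Neighbourhoods G
  NarrowPair : Set
  NarrowPair = ∃ λ u → ∃ λ v → u ≢ v × ¬ u ~ v × deg∪ u v < m + m
  narrowPair? : Dec NarrowPair
  narrowPair? = any? λ u → any? λ v → ¬? (u ≟ v) ×-dec ¬? (u ~? v) ×-dec deg∪ u v <? m + m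
  k≤commonNonNeighbours : ∀ {u v} → deg∪ u v < m + m → k ≤ count (commonNonNeighbour? u v)
  k≤commonNonNeighbours {u} {v} narrow = +-cancelʳ-≤ (m + m + 1) k C (begin
    k + (m + m + 1)          ≤⟨ k+2m+1≤N ⟩
    N                        ≤⟨ n≤commonNonNeighbours+deg∪+2 u v ⟩
    C + (deg∪ u v + 2)       ≡⟨ cong (C +_) (+-suc (deg∪ u v) 1) ⟩
    C + (suc (deg∪ u v) + 1) ≤⟨ +-monoʳ-≤ C (+-monoˡ-≤ 1 narrow) ⟩
    C + (m + m + 1)          ∎)
    where
    open ≤-Reasoning
    C : ℕ
    C = count (commonNonNeighbour? u v)
  C4-or-book : Dec (∃ λ a → ∃ λ b → ∃ λ c → ∃ λ d → FourCycle a b c d) → Dec NarrowPair →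
               (C4 ⊆G G) ⊎ (Book k ⊆G complement G)
  C4-or-book (yes (_ , _ , _ , _ , cycle)) _ = inj₁ (fourCycle⇒C4⊆G cycle)
  C4-or-book (no _) (yes (_ , _ , u≢v , u≁v , narrow)) =
    let (g , g-injective , gC) =
          count⇒injection (commonNonNeighbour? _ _) (k≤commonNonNeighbours narrow)
    in inj₂ (book⊆complement g u≢v u≁v g-injective gC)
  C4-or-book (no noCycle) (no noNarrow) = ⊥-elim (fourCycleFree∧largeUnions⇒⊥ {G = G}
    (λ cycle → noCycle (_ , _ , _ , _ , cycle))
    (λ u≢v u≁v → ≮⇒≥ λ narrow → noNarrow (_ , _ , u≢v , u≁v , narrow))
    3≤m m<N N<m[m+1])

^2≡* : ∀ m → m ^ 2 ≡ m * m
^2≡* m = cong (m *_) (*-identityʳ m)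

bookPages+2m+1≡m²+t : ∀ {m} t → 3 ≤ m → (m ∸ 1) ^ 2 + t ∸ 2 + (m + m + 1) ≡ m ^ 2 + t
bookPages+2m+1≡m²+t {suc k} t (s≤s 2≤k) = begin
  k ^ 2 + t ∸ 2 + (suc k + suc k + 1)   ≡⟨ shift (k ^ 2 + t ∸ 2) k ⟩
  k ^ 2 + t ∸ 2 + 2 + (k + k + 1)       ≡⟨ cong (_+ (k + k + 1)) (m∸n+n≡m 2≤k²+t) ⟩
  k ^ 2 + t + (k + k + 1)               ≡⟨ cong (λ x → x + t + (k + k + 1)) (^2≡* k) ⟩
  k * k + t + (k + k + 1)               ≡⟨ square k t ⟩
  suc k * suc k + t                     ≡⟨ cong (_+ t) (^2≡* (suc k)) ⟨
  suc k ^ 2 + t                         ∎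
  where
  open ≡-Reasoning
  shift : ∀ a k → a + (suc k + suc k + 1) ≡ a + 2 + (k + k + 1)
  shift = solve-∀
  square : ∀ k t → k * k + t + (k + k + 1) ≡ suc k * suc k + t
  square = solve-∀
  2≤k²+t : 2 ≤ k ^ 2 + t
  2≤k²+t = ≤-trans (≤-trans (s≤s (s≤s z≤n)) (^-monoˡ-≤ 2 2≤k)) (m≤m+n (k ^ 2) t)

theorem1 : (m t : ℕ) → 4 ≤ m → t < m →
             RamseyLE C4 (Book ((m ∸ 1) ^ 2 + t ∸ 2)) (m ^ 2 + t)
theorem1 m@(suc _) t 4≤m t<m =
  m ^ 2 + t , ≤-refl , arrows-C4-Book _ 3≤m m<N N<m[m+1] (≤-reflexive (bookPages+2m+1≡m²+t t 3≤m))
  where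
  open ≤-Reasoning
  3≤m : 3 ≤ m
  3≤m = ≤-trans (n≤1+n 3) 4≤m
  m<N : m < m ^ 2 + t
  m<N = begin-strict
    m          <⟨ m<m*n m m (≤-trans (s≤s (s≤s z≤n)) 4≤m) ⟩
    m * m      ≡⟨ ^2≡* m ⟨
    m ^ 2      ≤⟨ m≤m+n (m ^ 2) t ⟩
    m ^ 2 + t  ∎
  N<m[m+1] : m ^ 2 + t < m * suc m
  N<m[m+1] = begin-strict
    m ^ 2 + t  <⟨ +-monoʳ-< (m ^ 2) t<m ⟩
    m ^ 2 + m  ≡⟨ cong (_+ m) (^2≡* m) ⟩
    m * m + m  ≡⟨ +-comm (m * m) m ⟩
    m + m * m  ≡⟨ *-suc m m ⟨
    m * suc m  ∎
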